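{- Let $\mathfrak X$ be a homogeneous tree of degree $q+1$ ($q\geq1$). Fix integers $k,\ell$ with $2\leq k<\ell$, let $d=\gcd(k,\ell)$, and let $W(x)=\dfrac{U_{k-1}(x)}{U_{d-1}(x)}$ and $V(x)=\dfrac{U_{\ell-1}(x)}{U_{d-1}(x)}$ (these are polynomials). Then for all $f,g,h\in\mathcal F(\mathfrak X)$, the condition $$W(\mu_1)\big(g+U_{\ell-2}(\mu_1)f\big)=V(\mu_1)\big(h+U_{k-2}(\mu_1)f\big)$$ is necessary and sufficient for the existence of a wave $\{f_j\}_{j\in\mathbb Z}$ with $f_0=f$, $f_\ell=g$, and $f_k=h$.
   Context: $\mathfrak X$ is a tree in which every vertex has exactly $q+1$ edges; $\mathcal F(\mathfrak X)$ is the space of complex-valued functions on its vertices; $\mu_1f(v)=\frac{1}{q+1}\sum_{w\text{ adjacent to }v}f(w)$. A wave is a family $\{f_j\}_{j\in\mathbb Z}$ in $\mathcal F(\mathfrak X)$ with $\mu_1f_j=\frac{f_{j+1}+f_{j-1}}{2}$ for all $j\in\mathbb Z$. $U_n$: Chebyshev polynomials of the second kind, $U_0=1$, $U_1(x)=2x$, $U_n=2xU_{n-1}-U_{n-2}$; polynomials are applied to the operator $\mu_1$. -}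

module Defs where

open import Level using (Level; _⊔_) renaming (suc to lsuc)
open import Data.Nat as ℕ using (ℕ; zero; suc)
open import Data.Integer as ℤ using (ℤ; +_; -[1+_])
open import Data.Fin using (Fin; zero; suc)
open import Data.Fin.Properties using (_≟_)
open import Data.List using (List; []; _∷_; _++_; [_])
open import Data.Bool using (Bool; true; false; not; T)
open import Data.Unit using (⊤; tt)
open import Data.Product using (Σ; ∃; _×_; _,_; proj₁; proj₂)
open import Relation.Nullary using (¬_; yes; no)
open import Relation.Nullary.Decidable using (⌊_⌋; fromWitnessFalse)
open import Algebra.Bundles using (CommutativeRing)

-- Integer polynomials (coefficient lists, constant term first)

Polyℤ : Set
Polyℤ = List ℤ

infixl 6 _+ₚ_
_+ₚ_ : Polyℤ → Polyℤ → Polyℤ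
[] +ₚ q = q
(a ∷ p) +ₚ [] = a ∷ p
(a ∷ p) +ₚ (b ∷ q) = (a ℤ.+ b) ∷ (p +ₚ q)

scaleₚ : ℤ → Polyℤ → Polyℤ
scaleₚ c [] = []
scaleₚ c (a ∷ p) = (c ℤ.* a) ∷ scaleₚ c p

infixl 7 _*ₚ_
_*ₚ_ : Polyℤ → Polyℤ → Polyℤ
[] *ₚ q = []
(a ∷ p) *ₚ q = scaleₚ a q +ₚ (+ 0 ∷ (p *ₚ q))

coeff : Polyℤ → ℕ → ℤ
coeff [] i = + 0
coeff (a ∷ p) zero = a
coeff (a ∷ p) (suc i) = coeff p i

-- equality of polynomials (coefficientwise, insensitive to trailing zeros)
infix 4 _≈ₚ_
_≈ₚ_ : Polyℤ → Polyℤ → Set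
p ≈ₚ q = ∀ i → coeff p i ≡ coeff q i
  where open import Relation.Binary.PropositionalEquality using (_≡_)

U : ℕ → Polyℤ
U zero = + 1 ∷ []
U (suc zero) = + 0 ∷ + 2 ∷ []
U (suc (suc n)) = (+ 0 ∷ scaleₚ (+ 2) (U (suc n))) +ₚ scaleₚ (ℤ.- (+ 1)) (U n)

-- Algebraically closed fields of characteristic zero (stand-in for ℂ)

module RingAux {c ℓ} (R : CommutativeRing c ℓ) where
  open CommutativeRing R using (Carrier; _+_; _*_; -_; 0#; 1#)

  ιℕ : ℕ → Carrier
  ιℕ zero = 0#
  ιℕ (suc n) = 1# + ιℕ n

  ιℤ : ℤ → Carrier
  ιℤ (+ n) = ιℕ n
  ιℤ -[1+ n ] = - ιℕ (suc n)

  evalK : List Carrier → Carrier → Carrier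
  evalK [] x = 0#
  evalK (a ∷ p) x = a + x * evalK p x

record ACField0 (c ℓ : Level) : Set (lsuc (c ⊔ ℓ)) where
  field
    commRing : CommutativeRing c ℓ
  open CommutativeRing commRing public using (Carrier; _≈_; _+_; _*_; -_; 0#; 1#)
  open RingAux commRing public

  field
    nontrivial : ¬ (1# ≈ 0#)
    inverse : ∀ x → ¬ (x ≈ 0#) → Σ Carrier (λ y → x * y ≈ 1#)
    char0 : ∀ n → ¬ (ιℕ (suc n) ≈ 0#)
    -- every monic polynomial of degree ≥ 1 has a root
    algClosed : ∀ (a : Carrier) (cs : List Carrier) →
                Σ Carrier (λ x → evalK (a ∷ cs ++ [ 1# ]) x ≈ 0#)

  inv : ∀ x → ¬ (x ≈ 0#) → Carrier
  inv x nz = proj₁ (inverse x nz)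

  half : Carrier
  half = inv (ιℕ 2) (char0 1)

-- The homogeneous tree of degree m: reduced words in the free product of
-- m copies of ℤ/2 (its Cayley graph is the m-regular tree).
-- A word is stored with its most recent letter first.

Reduced : ∀ {m} → List (Fin m) → Set
Reduced [] = ⊤
Reduced (a ∷ []) = ⊤
Reduced (a ∷ b ∷ w) = T (not ⌊ a ≟ b ⌋) × Reduced (b ∷ w)

Vertex : ℕ → Set
Vertex m = Σ (List (Fin m)) Reduced

private
  reduced-tail : ∀ {m} {b : Fin m} {w} → Reduced (b ∷ w) → Reduced w
  reduced-tail {w = []} r = tt
  reduced-tail {w = c ∷ w} r = proj₂ r

step : ∀ {m} → Fin m → Vertex m → Vertex m
step a ([] , r) = (a ∷ [] , tt)
step a (b ∷ w , r) with a ≟ b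
... | yes _ = (w , reduced-tail {b = b} r)
... | no a≢b = (a ∷ b ∷ w , fromWitnessFalse a≢b , r)

module TreeAnalysis {c ℓ} (K : ACField0 c ℓ) (q : ℕ) where
  open ACField0 K
  open import Relation.Binary.PropositionalEquality using (_≡_)

  𝔛 : Set
  𝔛 = Vertex (suc q)

  𝓕 : Set c
  𝓕 = 𝔛 → Carrier

  infix 4 _≐_
  infixl 6 _⊕_
  _≐_ : 𝓕 → 𝓕 → Set ℓ
  f ≐ g = ∀ v → f v ≈ g v

  _⊕_ : 𝓕 → 𝓕 → 𝓕
  (f ⊕ g) v = f v + g v

  sumFin : ∀ {n} → (Fin n → Carrier) → Carrier
  sumFin {zero} φ = 0#
  sumFin {suc n} φ = φ zero + sumFin (λ i → φ (suc i))

  μ₁ : 𝓕 → 𝓕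
  μ₁ f v = inv (ιℕ (suc q)) (char0 q) * sumFin (λ a → f (step a v))

  poly[μ₁] : Polyℤ → 𝓕 → 𝓕
  poly[μ₁] [] f v = 0#
  poly[μ₁] (a ∷ p) f v = ιℤ a * f v + μ₁ (poly[μ₁] p f) v

  IsWave : (ℤ → 𝓕) → Set ℓ
  IsWave F = ∀ (j : ℤ) → μ₁ (F j) ≐ (λ v → half * (F (j ℤ.+ + 1) v + F (j ℤ.- + 1) v))

module Submission where

-- A wave is determined by F 0 and F 1: the wave equation reads F (j + 1) + F (j - 1) = 2μ₁ F j,
-- whence F (n + 1) + U_{n-1}(μ₁) F 0 = U_n(μ₁) F 1. So a wave through f, g, h at 0, l, k exists
-- iff some φ solves U_{l-1}(μ₁) φ = G and U_{k-1}(μ₁) φ = H, where G = g + U_{l-2}(μ₁) f and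
-- H = h + U_{k-2}(μ₁) f. Necessity of W G = V H follows from W U_{l-1} = W V U_{d-1} = V U_{k-1}.
--
-- For sufficiency, every polynomial in μ₁ with nonzero leading coefficient is surjective on 𝓕:
-- over the algebraically closed field it factors into terms μ₁ - ρ, and (μ₁ - ρ) φ = χ can be
-- solved outward from a root of the tree, because every vertex has a child besides its parent
-- (q ≥ 1). Hence G = U_{d-1} G₁ and H = U_{d-1} H₁, and W G = V H gives U_{k-1} G₁ = U_{l-1} H₁.
-- Euclid's algorithm, run with the addition formula and Cassini's identity for Chebyshev
-- polynomials, gives integer polynomials P, Q with P U_{k-1} + Q U_{l-1} = U_{d-1}, and then
-- φ = P H₁ + Q G₁ solves both equations.

open import Defs
open import Data.Nat using (ℕ; _≤_; _<_; _∸_)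
open import Data.Nat using (suc; s≤s)
open import Data.Nat.GCD using (gcd)
open import Data.Integer using (ℤ; +_)
open import Data.Product using (Σ; _×_)
open import Function.Bundles using (_⇔_)
open import Algebra.Bundles using (CommutativeRing; CommutativeMonoid)

module IntegerCoefficients {c ℓ} (R : CommutativeRing c ℓ) where
  open import Data.Nat as ℕ using (zero; suc)
  open import Data.Integer as ℤ using (-[1+_])
  import Data.Nat.Properties as ℕ
  import Data.Integer.Properties as ℤ
  import Data.Sign.Base as Sign
  open import Data.Maybe using (just; nothing)
  open import Relation.Nullary using (yes; no)
  open import Relation.Binary.PropositionalEquality as ≡ using (_≡_)
  open import Relation.Binary.Definitions using (WeaklyDecidable)
  open import Algebra.Solver.Ring.AlmostCommutativeRing
    using (_-Raw-AlmostCommutative⟶_; fromCommutativeRing; Induced-equivalence)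
  open CommutativeRing R
  open import Algebra.Definitions.RawMonoid +-rawMonoid renaming (_×_ to _×ₙ_)
  open import Algebra.Properties.Monoid.Mult +-monoid using (×-homo-+)
  open import Algebra.Properties.Semiring.Mult semiring using (×1-homo-*)
  open import Algebra.Properties.Ring ring using (-‿distribˡ-*; -‿distribʳ-*; -0#≈0#; -‿involutive; -‿+-comm)
  open import Algebra.Properties.CommutativeSemigroup +-commutativeSemigroup using (interchange)
  open import Relation.Binary.Reasoning.Setoid setoid
  open RingAux R

  ιℕ≡×1# : ∀ n → ιℕ n ≡ n ×ₙ 1#
  ιℕ≡×1# zero = ≡.refl
  ιℕ≡×1# (suc n) = ≡.cong (_+_ 1#) (ιℕ≡×1# n)

  ιℕ-+ : ∀ m n → ιℕ (m ℕ.+ n) ≈ ιℕ m + ιℕ n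
  ιℕ-+ m n rewrite ιℕ≡×1# (m ℕ.+ n) | ιℕ≡×1# m | ιℕ≡×1# n = ×-homo-+ 1# m n

  ιℕ-* : ∀ m n → ιℕ (m ℕ.* n) ≈ ιℕ m * ιℕ n
  ιℕ-* m n rewrite ιℕ≡×1# (m ℕ.* n) | ιℕ≡×1# m | ιℕ≡×1# n = ×1-homo-* m n

  ιℤ-⊖ : ∀ m n → ιℤ (m ℤ.⊖ n) ≈ ιℕ m + - ιℕ n
  ιℤ-⊖ zero zero = sym (trans (+-congˡ -0#≈0#) (+-identityʳ 0#))
  ιℤ-⊖ zero (suc n) = sym (+-identityˡ _)
  ιℤ-⊖ (suc m) zero = sym (trans (+-congˡ -0#≈0#) (+-identityʳ _))
  ιℤ-⊖ (suc m) (suc n) rewrite ℤ.[1+m]⊖[1+n]≡m⊖n m n = begin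
    ιℤ (m ℤ.⊖ n)                    ≈⟨ ιℤ-⊖ m n ⟩
    ιℕ m + - ιℕ n                   ≈⟨ +-identityˡ _ ⟨
    0# + (ιℕ m + - ιℕ n)            ≈⟨ +-congʳ (-‿inverseʳ 1#) ⟨
    (1# + - 1#) + (ιℕ m + - ιℕ n)   ≈⟨ interchange 1# (- 1#) (ιℕ m) (- ιℕ n) ⟩
    (1# + ιℕ m) + (- 1# + - ιℕ n)   ≈⟨ +-congˡ (-‿+-comm 1# (ιℕ n)) ⟩
    (1# + ιℕ m) + - (1# + ιℕ n)     ∎

  ιℤ-+ : ∀ i j → ιℤ (i ℤ.+ j) ≈ ιℤ i + ιℤ j
  ιℤ-+ (+ m) (+ n) = ιℕ-+ m n
  ιℤ-+ (+ m) -[1+ n ] = ιℤ-⊖ m (suc n)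
  ιℤ-+ -[1+ m ] (+ n) = trans (ιℤ-⊖ n (suc m)) (+-comm _ _)
  ιℤ-+ -[1+ m ] -[1+ n ] = begin
    - ιℕ (suc (suc m ℕ.+ n))        ≡⟨ ≡.cong (λ k → - ιℕ (suc k)) (ℕ.+-suc m n) ⟨
    - ιℕ (suc m ℕ.+ suc n)          ≈⟨ -‿cong (ιℕ-+ (suc m) (suc n)) ⟩
    - (ιℕ (suc m) + ιℕ (suc n))     ≈⟨ -‿+-comm _ _ ⟨
    - ιℕ (suc m) + - ιℕ (suc n)     ∎

  ιℤ-- : ∀ i → ιℤ (ℤ.- i) ≈ - ιℤ i
  ιℤ-- (+ zero) = sym -0#≈0#
  ιℤ-- (+ suc n) = refl
  ιℤ-- -[1+ n ] = sym (-‿involutive _)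

  ιℤ-+◃ : ∀ n → ιℤ (Sign.+ ℤ.◃ n) ≈ ιℕ n
  ιℤ-+◃ zero = refl
  ιℤ-+◃ (suc n) = refl

  ιℤ--◃ : ∀ n → ιℤ (Sign.- ℤ.◃ n) ≈ - ιℕ n
  ιℤ--◃ zero = sym -0#≈0#
  ιℤ--◃ (suc n) = refl

  ιℤ-* : ∀ i j → ιℤ (i ℤ.* j) ≈ ιℤ i * ιℤ j
  ιℤ-* (+ m) (+ n) = trans (ιℤ-+◃ (m ℕ.* n)) (ιℕ-* m n)
  ιℤ-* (+ m) -[1+ n ] = trans (ιℤ--◃ (m ℕ.* suc n)) (trans (-‿cong (ιℕ-* m (suc n))) (-‿distribʳ-* _ _))
  ιℤ-* -[1+ m ] (+ n) = trans (ιℤ--◃ (suc m ℕ.* n)) (trans (-‿cong (ιℕ-* (suc m) n)) (-‿distribˡ-* _ _))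
  ιℤ-* -[1+ m ] -[1+ n ] = trans (ιℤ-+◃ (suc m ℕ.* suc n)) (trans (ιℕ-* (suc m) (suc n))
    (trans (sym (-‿involutive _)) (trans (-‿cong (-‿distribˡ-* _ _)) (-‿distribʳ-* _ _))))

  ιℤ-homomorphism : CommutativeRing.rawRing ℤ.+-*-commutativeRing -Raw-AlmostCommutative⟶ fromCommutativeRing R
  ιℤ-homomorphism = record
    { ⟦_⟧ = ιℤ ; +-homo = ιℤ-+ ; *-homo = ιℤ-* ; -‿homo = ιℤ--
    ; 0-homo = refl ; 1-homo = +-identityʳ 1# }

  ≟-weak : WeaklyDecidable (Induced-equivalence ιℤ-homomorphism)
  ≟-weak i j with i ℤ.≟ j
  ... | yes ≡.refl = just refl
  ... | no _ = nothing

  open import Algebra.Solver.Ring (CommutativeRing.rawRing ℤ.+-*-commutativeRing)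
    (fromCommutativeRing R) ιℤ-homomorphism ≟-weak public
    using (solve; _:=_; _:+_; _:-_; _:*_; :-_)

-- Chebyshev sequences and Euclid's algorithm

module _ {p} (P : ℕ → ℕ → ℕ → Set p) where
  open import Data.Nat using (zero; suc; _+_)
  open import Data.Nat.Properties using (≤-total; ≤-refl; m+[n∸m]≡n; +-comm; ≤-pred; ≤-trans; m≤n+m)
  open import Data.Nat.GCD using (gcd-GCD; gcd-identityˡ; gcd-comm; module GCD)
  open import Data.Sum using (inj₁; inj₂)
  open import Relation.Binary.PropositionalEquality using (_≡_; subst; sym)

  gcd-induction : (∀ n → P 0 n n) → (∀ {m n d} → P m n d → P n m d) →
                  (∀ {m n d} → P m n d → P m (m + n) d) → ∀ m n → P m n (gcd m n)
  gcd-induction base swap step m n = go (m + n) m n ≤-refl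
    where
    gcd-step : ∀ m n → gcd m (m + n) ≡ gcd m n
    gcd-step m n = GCD.unique (gcd-GCD m (m + n)) (GCD.step (gcd-GCD m n))

    go : ∀ s m n → m + n ≤ s → P m n (gcd m n)
    go-≤ : ∀ s m n → m ≤ n → m + n ≤ s → P m n (gcd m n)
    go s m n m+n≤s with ≤-total m n
    ... | inj₁ m≤n = go-≤ s m n m≤n m+n≤s
    ... | inj₂ n≤m = subst (P m n) (gcd-comm n m) (swap (go-≤ s n m n≤m (subst (_≤ s) (+-comm m n) m+n≤s)))
    go-≤ s zero n _ _ = subst (P 0 n) (sym (gcd-identityˡ n)) (base n)
    go-≤ (suc s) (suc m) n m≤n m+n≤s = subst (λ k → P (suc m) k (gcd (suc m) k)) (m+[n∸m]≡n m≤n)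
      (subst (P (suc m) (suc m + (n ∸ suc m))) (sym (gcd-step (suc m) (n ∸ suc m)))
        (step (go s (suc m) (n ∸ suc m) (subst (_≤ s) (sym (m+[n∸m]≡n m≤n)) (≤-trans (m≤n+m n m) (≤-pred m+n≤s))))))

module Lucas {c ℓ} (R : CommutativeRing c ℓ) (x : CommutativeRing.Carrier R) where
  open import Level using (_⊔_)
  open import Data.Nat as ℕ using (zero; suc)
  import Data.Nat.Properties as ℕ
  open import Data.Product using (_,_)
  open import Relation.Binary.PropositionalEquality as ≡ using ()
  open CommutativeRing R
  open IntegerCoefficients R using (solve; _:=_; _:+_; _:-_; _:*_; :-_)
  open import Algebra.Properties.Ring ring using (-0#≈0#)
  open import Relation.Binary.Reasoning.Setoid setoid

  -- u (suc n) is Uₙ(x/2). Cassini's identity makes u (m ∸ 1) a unit modulo u m, so that Euclid's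
  -- algorithm runs on these polynomials and puts u (gcd m n) in the ideal generated by u m and u n.
  u : ℕ → Carrier
  u zero = 0#
  u (suc zero) = 1#
  u (suc (suc n)) = x * u (suc n) - u n

  y-0≈y : ∀ y → y - 0# ≈ y
  y-0≈y y = trans (+-congˡ -0#≈0#) (+-identityʳ y)

  u₂≈x : u 2 ≈ x
  u₂≈x = trans (y-0≈y (x * 1#)) (*-identityʳ x)

  u-+ : ∀ m n → u (m ℕ.+ suc n) ≈ u (suc m) * u (suc n) - u n * u m
  u-+ zero n = sym (trans (+-cong (*-identityˡ _) (-‿cong (zeroʳ _))) (y-0≈y _))
  u-+ (suc zero) n = +-cong (*-congʳ (sym u₂≈x)) (-‿cong (sym (*-identityʳ _)))
  u-+ (suc (suc m)) n = begin
    x * u (suc m ℕ.+ suc n) - u (m ℕ.+ suc n)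
      ≈⟨ +-cong (*-congˡ (u-+ (suc m) n)) (-‿cong (u-+ m n)) ⟩
    x * (u (suc (suc m)) * u (suc n) - u n * u (suc m)) - (u (suc m) * u (suc n) - u n * u m)
      ≈⟨ solve 6 (λ X A B C D E → X :* (D :* A :- B :* C) :- (C :* A :- B :* E) := (X :* D :- C) :* A :- B :* (X :* C :- E))
           refl x (u (suc n)) (u n) (u (suc m)) (u (suc (suc m))) (u m) ⟩
    u (suc (suc (suc m))) * u (suc n) - u n * u (suc (suc m)) ∎

  u-cassini : ∀ n → u (suc n) * u (suc n) - u (suc (suc n)) * u n ≈ 1#
  u-cassini zero = trans (+-cong (*-identityˡ 1#) (-‿cong (zeroʳ _))) (y-0≈y 1#)
  u-cassini (suc n) = begin
    u (suc (suc n)) * u (suc (suc n)) - (x * u (suc (suc n)) - u (suc n)) * u (suc n)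
      ≈⟨ solve 3 (λ X P Q → (X :* Q :- P) :* (X :* Q :- P) :- (X :* (X :* Q :- P) :- Q) :* Q := Q :* Q :- (X :* Q :- P) :* P)
           refl x (u n) (u (suc n)) ⟩
    u (suc n) * u (suc n) - u (suc (suc n)) * u n
      ≈⟨ u-cassini n ⟩
    1# ∎

  infix 4 _∈⟨_,_⟩
  _∈⟨_,_⟩ : Carrier → Carrier → Carrier → Set (c ⊔ ℓ)
  z ∈⟨ a , b ⟩ = Σ Carrier λ s → Σ Carrier λ t → s * a + t * b ≈ z

  ∈⟨⟩-swap : ∀ {z a b} → z ∈⟨ a , b ⟩ → z ∈⟨ b , a ⟩
  ∈⟨⟩-swap (s , t , eq) = t , s , trans (+-comm _ _) eq

  ∈⟨⟩-trans : ∀ {z a b c} → z ∈⟨ a , b ⟩ → b ∈⟨ a , c ⟩ → z ∈⟨ a , c ⟩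
  ∈⟨⟩-trans {z} {a} {b} {c} (s , t , eq) (s′ , t′ , eq′) = s + t * s′ , t * t′ , (begin
    (s + t * s′) * a + t * t′ * c
      ≈⟨ solve 6 (λ S T S′ T′ A C → (S :+ T :* S′) :* A :+ T :* T′ :* C := S :* A :+ T :* (S′ :* A :+ T′ :* C))
           refl s t s′ t′ a c ⟩
    s * a + t * (s′ * a + t′ * c)  ≈⟨ +-congˡ (*-congˡ eq′) ⟩
    s * a + t * b                  ≈⟨ eq ⟩
    z                              ∎)

  u∈⟨u,u+⟩ : ∀ m n → u n ∈⟨ u m , u (m ℕ.+ n) ⟩
  u∈⟨u,u+⟩ zero n = 0# , 1# , trans (+-cong (zeroˡ _) (*-identityˡ _)) (+-identityˡ _)
  u∈⟨u,u+⟩ (suc zero) n = u n , 0# , trans (+-cong (*-identityʳ _) (zeroˡ _)) (+-identityʳ _)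
  u∈⟨u,u+⟩ (suc (suc m)) n = M , - A₁ , (begin
    M * A + - A₁ * u (suc (suc m) ℕ.+ n)
      ≈⟨ +-congˡ (*-congˡ (trans (reflexive (≡.cong u (ℕ.+-comm (suc (suc m)) n))) (u-+ n (suc m)))) ⟩
    M * A + - A₁ * (C₁ * A - A₁ * C)
      ≈⟨ solve 6 (λ A A₁ A₂ C C₁ M → (A₁ :* C₁ :- A₂ :* C) :* A :+ :- A₁ :* (C₁ :* A :- A₁ :* C) := C :* (A₁ :* A₁ :- A :* A₂))
           refl A A₁ (u m) C C₁ M ⟩
    C * (A₁ * A₁ - A * u m)
      ≈⟨ *-congˡ (u-cassini m) ⟩
    C * 1#
      ≈⟨ *-identityʳ C ⟩
    C ∎)
    where
    A A₁ C C₁ M : Carrier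
    A = u (suc (suc m))
    A₁ = u (suc m)
    C = u n
    C₁ = u (suc n)
    M = A₁ * C₁ - u m * C

  u-gcd∈⟨u,u⟩ : ∀ m n → u (gcd m n) ∈⟨ u m , u n ⟩
  u-gcd∈⟨u,u⟩ = gcd-induction (λ m n d → u d ∈⟨ u m , u n ⟩)
    (u∈⟨u,u+⟩ 0) ∈⟨⟩-swap (λ {m} {n} d∈ → ∈⟨⟩-trans d∈ (u∈⟨u,u+⟩ m n))

module _ where
  open import Data.Nat as ℕ using (zero; suc; _^_; _⊔_; s≤s)
  import Data.Nat.Properties as ℕ
  open import Data.Integer as ℤ using (-[1+_])
  import Data.Integer.Properties as ℤ
  open import Data.List using (List; []; _∷_; _++_; [_]; length)
  open import Data.List.Properties using (length-++)
  open import Data.Product using (_,_)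
  open import Relation.Binary.PropositionalEquality using (_≡_; refl; sym; trans; cong; cong₂; subst₂; module ≡-Reasoning)
  open ≡-Reasoning

  scaleₚ-++ : ∀ a cs x → scaleₚ a (cs ++ [ x ]) ≡ scaleₚ a cs ++ [ a ℤ.* x ]
  scaleₚ-++ a [] x = refl
  scaleₚ-++ a (c ∷ cs) x = cong (a ℤ.* c ∷_) (scaleₚ-++ a cs x)

  length-scaleₚ : ∀ a p → length (scaleₚ a p) ≡ length p
  length-scaleₚ a [] = refl
  length-scaleₚ a (c ∷ p) = cong suc (length-scaleₚ a p)

  length-+ₚ : ∀ p q → length (p +ₚ q) ≡ length p ⊔ length q
  length-+ₚ [] q = refl
  length-+ₚ (a ∷ p) [] = refl
  length-+ₚ (a ∷ p) (b ∷ q) = cong suc (length-+ₚ p q)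

  ++-+ₚ : ∀ cs ds x → length ds ≤ length cs → (cs ++ [ x ]) +ₚ ds ≡ (cs +ₚ ds) ++ [ x ]
  ++-+ₚ [] [] x _ = refl
  ++-+ₚ (c ∷ cs) [] x _ = refl
  ++-+ₚ (c ∷ cs) (d ∷ ds) x (s≤s ds≤cs) = cong (c ℤ.+ d ∷_) (++-+ₚ cs ds x ds≤cs)

  U-leading : ∀ n → Σ (List ℤ) λ cs → length cs ≡ n × U n ≡ cs ++ [ + (2 ^ n) ]
  U-leading zero = [] , refl , refl
  U-leading (suc zero) = + 0 ∷ [] , refl , refl
  U-leading (suc (suc n)) with U-leading (suc n) | U-leading n
  ... | cs₁ , len₁ , eq₁ | cs₀ , len₀ , eq₀ = hi +ₚ lo , len , eq
    where
    hi lo : List ℤ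
    hi = + 0 ∷ scaleₚ (+ 2) cs₁
    lo = scaleₚ -[1+ 0 ] (cs₀ ++ [ + (2 ^ n) ])
    len-hi : length hi ≡ suc (suc n)
    len-hi = cong suc (trans (length-scaleₚ _ cs₁) len₁)
    len-lo : length lo ≡ suc n
    len-lo = trans (length-scaleₚ -[1+ 0 ] (cs₀ ++ [ + (2 ^ n) ])) (trans (length-++ cs₀) (trans (cong (ℕ._+ 1) len₀) (ℕ.+-comm n 1)))
    lo≤hi : length lo ≤ length hi
    lo≤hi = subst₂ _≤_ (sym len-lo) (sym len-hi) (ℕ.n≤1+n _)
    len : length (hi +ₚ lo) ≡ suc (suc n)
    len = trans (length-+ₚ hi lo) (trans (ℕ.m≥n⇒m⊔n≡m lo≤hi) len-hi)
    eq : U (suc (suc n)) ≡ (hi +ₚ lo) ++ [ + (2 ^ suc (suc n)) ]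
    eq = begin
      (+ 0 ∷ scaleₚ (+ 2) (U (suc n))) +ₚ scaleₚ -[1+ 0 ] (U n)
        ≡⟨ cong₂ (λ p r → (+ 0 ∷ scaleₚ (+ 2) p) +ₚ scaleₚ -[1+ 0 ] r) eq₁ eq₀ ⟩
      (+ 0 ∷ scaleₚ (+ 2) (cs₁ ++ [ + (2 ^ suc n) ])) +ₚ lo
        ≡⟨ cong (λ p → (+ 0 ∷ p) +ₚ lo) (scaleₚ-++ (+ 2) cs₁ _) ⟩
      (hi ++ [ + 2 ℤ.* + (2 ^ suc n) ]) +ₚ lo
        ≡⟨ ++-+ₚ hi lo _ lo≤hi ⟩
      (hi +ₚ lo) ++ [ + 2 ℤ.* + (2 ^ suc n) ]
        ≡⟨ cong (λ a → (hi +ₚ lo) ++ [ a ]) (ℤ.pos-* 2 (2 ^ suc n)) ⟨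
      (hi +ₚ lo) ++ [ + (2 ^ suc (suc n)) ] ∎

module _ {a ℓ} (M : CommutativeMonoid a ℓ) where
  open import Data.Nat using (zero; suc)
  open import Data.Fin using (Fin; zero; suc; punchIn)
  open import Data.Fin.Properties using (punchInᵢ≢i)
  open import Function using (_∘_)
  open import Relation.Binary.PropositionalEquality using (_≢_)
  open CommutativeMonoid M renaming (_∙_ to _+_; ε to 0#)
  open import Algebra.Properties.CommutativeMonoid.Sum M using (sum; sum-cong-≋; sum-remove; sum-replicate-zero)
  open import Algebra.Properties.CommutativeSemigroup commutativeSemigroup using (interchange)

  sum-+ : ∀ {n} (φ ψ : Fin n → Carrier) → sum (λ i → φ i + ψ i) ≈ sum φ + sum ψ
  sum-+ {zero} φ ψ = sym (identityˡ 0#)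
  sum-+ {suc n} φ ψ = trans (∙-congˡ (sum-+ (φ ∘ suc) (ψ ∘ suc))) (interchange _ _ _ _)

  sum-pick : ∀ {n} (t : Fin n → Carrier) j → (∀ i → i ≢ j → t i ≈ 0#) → sum t ≈ t j
  sum-pick {suc n} t j t≈0 = trans (sum-remove {i = j} t)
    (trans (∙-congˡ (trans (sum-cong-≋ (λ i → t≈0 (punchIn j i) (punchInᵢ≢i j i))) (sum-replicate-zero n)))
      (identityʳ (t j)))

module _ {m : ℕ} where
  open import Data.Fin using (Fin)
  open import Data.Fin.Properties using (_≟_)
  open import Data.List using (List; []; _∷_)
  open import Data.Bool.Properties using (T-irrelevant)
  open import Data.Product using (_,_; proj₁; proj₂)
  open import Data.Unit using (tt)
  open import Relation.Nullary using (yes; no; contradiction)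
  open import Relation.Nullary.Decidable using (fromWitnessFalse)
  open import Relation.Binary.PropositionalEquality using (_≡_; _≢_; refl; cong₂)

  Reduced-irrelevant : ∀ (w : List (Fin m)) (r r′ : Reduced w) → r ≡ r′
  Reduced-irrelevant [] _ _ = refl
  Reduced-irrelevant (a ∷ []) _ _ = refl
  Reduced-irrelevant (a ∷ b ∷ w) (t , r) (t′ , r′) = cong₂ _,_ (T-irrelevant t t′) (Reduced-irrelevant (b ∷ w) r r′)

  Reduced-tail : ∀ {b : Fin m} {w} → Reduced (b ∷ w) → Reduced w
  Reduced-tail {w = []} _ = tt
  Reduced-tail {w = c ∷ w} r = proj₂ r

  Reduced-∷ : ∀ {a b : Fin m} {w} → a ≢ b → Reduced (b ∷ w) → Reduced (a ∷ b ∷ w)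
  Reduced-∷ a≢b r = fromWitnessFalse a≢b , r

  step-back : ∀ (b : Fin m) w (r : Reduced (b ∷ w)) → proj₁ (step b (b ∷ w , r)) ≡ w
  step-back b w r with b ≟ b
  ... | yes _ = refl
  ... | no b≢b = contradiction refl b≢b

  step-forward : ∀ {a b : Fin m} w (r : Reduced (b ∷ w)) → a ≢ b → proj₁ (step a (b ∷ w , r)) ≡ a ∷ b ∷ w
  step-forward {a} {b} w r a≢b with a ≟ b
  ... | yes a≡b = contradiction a≡b a≢b
  ... | no _ = refl

-- μ₁ and integer polynomials in μ₁

module OnTree {c ℓ} (K : ACField0 c ℓ) (q : ℕ) where
  open import Level using (0ℓ; _⊔_)
  open import Data.Nat as ℕ using (zero; suc)
  import Data.Nat.Properties as ℕ
  open import Data.Integer as ℤ using (-[1+_])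
  open import Data.Fin using (Fin; zero; suc)
  open import Data.List using (List; []; _∷_; _++_; [_]; length; map)
  open import Data.List.Properties using (length-map)
  open import Data.Product using (_,_; proj₁; proj₂)
  open import Function using (_∘_)
  open import Function.Bundles using (mk⇔; Equivalence)
  open import Relation.Nullary using (¬_; contradiction)
  open import Relation.Binary.PropositionalEquality as ≡ using (_≡_; _≢_)
  open import Data.Sum using (inj₁)
  open import Data.Nat.GCD using (gcd[m,n]≢0)
  import Algebra.Construct.Pointwise
  open import Algebra.Structures using (IsCommutativeRing)
  open import Relation.Binary.Structures using (IsEquivalence)
  open import Relation.Binary.Bundles using (Setoid)
  import Relation.Binary.Reasoning.Setoid as Reasoning
  open ACField0 K using (commRing; ιℕ; ιℤ; evalK; inv; inverse; char0; algClosed; half)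
  open CommutativeRing commRing hiding (zero)
  open IntegerCoefficients commRing using (ιℤ-+; ιℤ-*; solve; _:=_; _:+_; _:-_; _:*_)
  open import Algebra.Properties.Ring ring using (-1*x≈-x)
  open import Algebra.Properties.CommutativeSemigroup *-commutativeSemigroup using (x∙yz≈y∙xz)
  open import Algebra.Properties.Semiring.Sum semiring using (sum; sum-cong-≋; *-distribˡ-sum)
  open TreeAnalysis K q

  𝓕-ring : CommutativeRing c ℓ
  𝓕-ring = Algebra.Construct.Pointwise.commutativeRing 𝔛 commRing

  module 𝓕 where
    open CommutativeRing 𝓕-ring public
    open Reasoning (CommutativeRing.setoid 𝓕-ring) public
    open import Algebra.Properties.Ring (CommutativeRing.ring 𝓕-ring) public using (+-cancelʳ)

  infixl 7 _·_
  _·_ : Carrier → 𝓕 → 𝓕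
  (a · f) v = a * f v

  infixl 6 _⊖_
  _⊖_ : 𝓕 → 𝓕 → 𝓕
  _⊖_ = 𝓕._-_

  sumFin≡sum : ∀ {n} (φ : Fin n → Carrier) → sumFin φ ≡ sum φ
  sumFin≡sum {zero} φ = ≡.refl
  sumFin≡sum {suc n} φ = ≡.cong (_+_ (φ zero)) (sumFin≡sum (φ ∘ suc))

  1/[1+q] : Carrier
  1/[1+q] = inv (ιℕ (suc q)) (char0 q)

  μ₁≡sum : ∀ f v → μ₁ f v ≡ 1/[1+q] * sum (λ a → f (step a v))
  μ₁≡sum f v = ≡.cong (1/[1+q] *_) (sumFin≡sum (λ a → f (step a v)))

  μ₁-cong : ∀ {f g} → f ≐ g → μ₁ f ≐ μ₁ g
  μ₁-cong {f} {g} f≐g v rewrite μ₁≡sum f v | μ₁≡sum g v = *-congˡ (sum-cong-≋ (λ a → f≐g (step a v)))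

  μ₁-+ : ∀ f g → μ₁ (f ⊕ g) ≐ μ₁ f ⊕ μ₁ g
  μ₁-+ f g v rewrite μ₁≡sum (f ⊕ g) v | μ₁≡sum f v | μ₁≡sum g v =
    trans (*-congˡ (sum-+ +-commutativeMonoid (λ a → f (step a v)) (λ a → g (step a v)))) (distribˡ _ _ _)

  μ₁-· : ∀ a f → μ₁ (a · f) ≐ a · μ₁ f
  μ₁-· a f v rewrite μ₁≡sum (a · f) v | μ₁≡sum f v =
    trans (*-congˡ (sym (*-distribˡ-sum a (λ b → f (step b v))))) (x∙yz≈y∙xz _ _ _)

  μ₁-+· : ∀ g a h → μ₁ (g ⊕ a · h) ≐ μ₁ g ⊕ a · μ₁ h
  μ₁-+· g a h = 𝓕.trans (μ₁-+ g (a · h)) (𝓕.+-congˡ (μ₁-· a h))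

  μ₁-0 : μ₁ 𝓕.0# ≐ 𝓕.0#
  μ₁-0 v = trans (μ₁-cong (λ _ → sym (zeroˡ 0#)) v) (trans (μ₁-· 0# 𝓕.0# v) (zeroˡ _))

  infixr 8 _⊙_
  _⊙_ : Polyℤ → 𝓕 → 𝓕
  _⊙_ = poly[μ₁]

  ⊙-cong : ∀ p {f g} → f ≐ g → p ⊙ f ≐ p ⊙ g
  ⊙-cong [] f≐g v = refl
  ⊙-cong (a ∷ p) f≐g v = +-cong (*-congˡ (f≐g v)) (μ₁-cong (⊙-cong p f≐g) v)

  ⊙-+ : ∀ p f g → p ⊙ (f ⊕ g) ≐ p ⊙ f ⊕ p ⊙ g
  ⊙-+ [] f g v = sym (+-identityˡ 0#)
  ⊙-+ (a ∷ p) f g v = trans (+-congˡ (trans (μ₁-cong (⊙-+ p f g) v) (μ₁-+ (p ⊙ f) (p ⊙ g) v)))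
    (solve 5 (λ A F G X Y → A :* (F :+ G) :+ (X :+ Y) := (A :* F :+ X) :+ (A :* G :+ Y)) refl (ιℤ a) (f v) (g v) _ _)

  ⊙-· : ∀ p a f → p ⊙ (a · f) ≐ a · (p ⊙ f)
  ⊙-· [] a f v = sym (zeroʳ a)
  ⊙-· (b ∷ p) a f v = trans (+-congˡ (trans (μ₁-cong (⊙-· p a f) v) (μ₁-· a (p ⊙ f) v)))
    (solve 4 (λ B A F X → B :* (A :* F) :+ A :* X := A :* (B :* F :+ X)) refl (ιℤ b) a (f v) _)

  ⊙-0 : ∀ p → p ⊙ 𝓕.0# ≐ 𝓕.0#
  ⊙-0 p v = trans (⊙-cong p (λ _ → sym (zeroˡ 0#)) v) (trans (⊙-· p 0# 𝓕.0# v) (zeroˡ _))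

  ⊙-μ₁ : ∀ p f → p ⊙ μ₁ f ≐ μ₁ (p ⊙ f)
  ⊙-μ₁ [] f v = sym (μ₁-0 v)
  ⊙-μ₁ (a ∷ p) f v = sym (trans (μ₁-+ (ιℤ a · f) (μ₁ (p ⊙ f)) v)
    (+-cong (μ₁-· (ιℤ a) f v) (μ₁-cong (𝓕.sym (⊙-μ₁ p f)) v)))

  ⊙-comm : ∀ p r f → p ⊙ r ⊙ f ≐ r ⊙ p ⊙ f
  ⊙-comm p [] f = ⊙-0 p
  ⊙-comm p (b ∷ r) f = 𝓕.trans (⊙-+ p (ιℤ b · f) (μ₁ (r ⊙ f)))
    (𝓕.+-cong (⊙-· p (ιℤ b) f) (𝓕.trans (⊙-μ₁ p (r ⊙ f)) (μ₁-cong (⊙-comm p r f))))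

  +ₚ-⊙ : ∀ p r f → (p +ₚ r) ⊙ f ≐ p ⊙ f ⊕ r ⊙ f
  +ₚ-⊙ [] r f v = sym (+-identityˡ _)
  +ₚ-⊙ (a ∷ p) [] f v = sym (+-identityʳ _)
  +ₚ-⊙ (a ∷ p) (b ∷ r) f v = trans (+-cong (*-congʳ (ιℤ-+ a b)) (trans (μ₁-cong (+ₚ-⊙ p r f) v) (μ₁-+ (p ⊙ f) (r ⊙ f) v)))
    (solve 5 (λ A B F X Y → (A :+ B) :* F :+ (X :+ Y) := (A :* F :+ X) :+ (B :* F :+ Y)) refl (ιℤ a) (ιℤ b) (f v) _ _)

  scaleₚ-⊙ : ∀ a p f → scaleₚ a p ⊙ f ≐ ιℤ a · p ⊙ f
  scaleₚ-⊙ a [] f v = sym (zeroʳ _)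
  scaleₚ-⊙ a (b ∷ p) f v = trans (+-cong (*-congʳ (ιℤ-* a b)) (trans (μ₁-cong (scaleₚ-⊙ a p f) v) (μ₁-· (ιℤ a) (p ⊙ f) v)))
    (solve 4 (λ A B F X → A :* B :* F :+ A :* X := A :* (B :* F :+ X)) refl (ιℤ a) (ιℤ b) (f v) _)

  0∷-⊙ : ∀ p f → (+ 0 ∷ p) ⊙ f ≐ μ₁ (p ⊙ f)
  0∷-⊙ p f v = trans (+-congʳ (zeroˡ _)) (+-identityˡ _)

  *ₚ-⊙ : ∀ p r f → (p *ₚ r) ⊙ f ≐ p ⊙ r ⊙ f
  *ₚ-⊙ [] r f v = refl
  *ₚ-⊙ (a ∷ p) r f = 𝓕.trans (+ₚ-⊙ (scaleₚ a r) (+ 0 ∷ p *ₚ r) f)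
    (𝓕.+-cong (scaleₚ-⊙ a r f) (𝓕.trans (0∷-⊙ (p *ₚ r) f) (μ₁-cong (*ₚ-⊙ p r f))))

  ≈ₚ[]-⊙ : ∀ p → p ≈ₚ [] → ∀ f → p ⊙ f ≐ 𝓕.0#
  ≈ₚ[]-⊙ [] _ f v = refl
  ≈ₚ[]-⊙ (a ∷ p) p≈[] f v with p≈[] 0
  ... | ≡.refl = trans (+-cong (zeroˡ _) (trans (μ₁-cong (≈ₚ[]-⊙ p (p≈[] ∘ suc) f) v) (μ₁-0 v))) (+-identityˡ 0#)

  ≈ₚ-⊙ : ∀ p r → p ≈ₚ r → ∀ f → p ⊙ f ≐ r ⊙ f
  ≈ₚ-⊙ [] r p≈r f = 𝓕.sym (≈ₚ[]-⊙ r (≡.sym ∘ p≈r) f)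
  ≈ₚ-⊙ (a ∷ p) [] p≈r f = ≈ₚ[]-⊙ (a ∷ p) p≈r f
  ≈ₚ-⊙ (a ∷ p) (b ∷ r) p≈r f v with p≈r 0
  ... | ≡.refl = +-congˡ (μ₁-cong (≈ₚ-⊙ p r (p≈r ∘ suc) f) v)

  1ₚ-⊙ : ∀ f → (+ 1 ∷ []) ⊙ f ≐ f
  1ₚ-⊙ f v = trans (+-cong (trans (*-congʳ (+-identityʳ 1#)) (*-identityˡ _)) (μ₁-0 v)) (+-identityʳ _)

  negₚ : Polyℤ → Polyℤ
  negₚ = scaleₚ -[1+ 0 ]

  negₚ-⊙ : ∀ p f → negₚ p ⊙ f ≐ 𝓕.- (p ⊙ f)
  negₚ-⊙ p f v = trans (scaleₚ-⊙ -[1+ 0 ] p f v) (trans (*-congʳ (-‿cong (+-identityʳ 1#))) (-1*x≈-x _))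

  -- Integer polynomials up to equality of the operators they induce on 𝓕. This quotient is a
  -- commutative ring, so identities between Chebyshev polynomials are proved in it by the ring
  -- solver rather than on coefficient lists.
  infix 4 _≃_
  record _≃_ (p r : Polyℤ) : Set (c ⊔ ℓ) where
    constructor mk≃
    field ⊙-≐ : ∀ f → p ⊙ f ≐ r ⊙ f
  open _≃_ public

  ≃-isEquivalence : IsEquivalence _≃_
  ≃-isEquivalence = record
    { refl = mk≃ λ f → 𝓕.refl
    ; sym = λ p≃r → mk≃ λ f → 𝓕.sym (⊙-≐ p≃r f)
    ; trans = λ p≃r r≃s → mk≃ λ f → 𝓕.trans (⊙-≐ p≃r f) (⊙-≐ r≃s f) }

  ≃-setoid : Setoid 0ℓ (c ⊔ ℓ)
  ≃-setoid = record { isEquivalence = ≃-isEquivalence }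

  +ₚ-cong : ∀ {p p′ r r′} → p ≃ p′ → r ≃ r′ → p +ₚ r ≃ p′ +ₚ r′
  +ₚ-cong {p} {p′} {r} {r′} p≃p′ r≃r′ = mk≃ λ f →
    𝓕.trans (+ₚ-⊙ p r f) (𝓕.trans (𝓕.+-cong (⊙-≐ p≃p′ f) (⊙-≐ r≃r′ f)) (𝓕.sym (+ₚ-⊙ p′ r′ f)))

  +ₚ-assoc : ∀ p r s → (p +ₚ r) +ₚ s ≃ p +ₚ (r +ₚ s)
  +ₚ-assoc p r s = mk≃ λ f → begin
    (p +ₚ r +ₚ s) ⊙ f            ≈⟨ 𝓕.trans (+ₚ-⊙ (p +ₚ r) s f) (𝓕.+-congʳ (+ₚ-⊙ p r f)) ⟩
    p ⊙ f ⊕ r ⊙ f ⊕ s ⊙ f        ≈⟨ 𝓕.+-assoc _ _ _ ⟩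
    p ⊙ f ⊕ (r ⊙ f ⊕ s ⊙ f)      ≈⟨ 𝓕.trans (+ₚ-⊙ p (r +ₚ s) f) (𝓕.+-congˡ (+ₚ-⊙ r s f)) ⟨
    (p +ₚ (r +ₚ s)) ⊙ f          ∎
    where open 𝓕 using (begin_; _∎; step-≈-⟩; step-≈-⟨)

  +ₚ-comm : ∀ p r → p +ₚ r ≃ r +ₚ p
  +ₚ-comm p r = mk≃ λ f → 𝓕.trans (+ₚ-⊙ p r f) (𝓕.trans (𝓕.+-comm _ _) (𝓕.sym (+ₚ-⊙ r p f)))

  +ₚ-identityʳ : ∀ p → p +ₚ [] ≃ p
  +ₚ-identityʳ p = mk≃ λ f → 𝓕.trans (+ₚ-⊙ p [] f) (𝓕.+-identityʳ _)

  negₚ-cong : ∀ {p r} → p ≃ r → negₚ p ≃ negₚ r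
  negₚ-cong {p} {r} p≃r = mk≃ λ f → 𝓕.trans (negₚ-⊙ p f) (𝓕.trans (𝓕.-‿cong (⊙-≐ p≃r f)) (𝓕.sym (negₚ-⊙ r f)))

  negₚ-inverseˡ : ∀ p → negₚ p +ₚ p ≃ []
  negₚ-inverseˡ p = mk≃ λ f → 𝓕.trans (+ₚ-⊙ (negₚ p) p f) (𝓕.trans (𝓕.+-congʳ (negₚ-⊙ p f)) (𝓕.-‿inverseˡ _))

  negₚ-inverseʳ : ∀ p → p +ₚ negₚ p ≃ []
  negₚ-inverseʳ p = mk≃ λ f → 𝓕.trans (+ₚ-⊙ p (negₚ p) f) (𝓕.trans (𝓕.+-congˡ (negₚ-⊙ p f)) (𝓕.-‿inverseʳ _))

  *ₚ-cong : ∀ {p p′ r r′} → p ≃ p′ → r ≃ r′ → p *ₚ r ≃ p′ *ₚ r′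
  *ₚ-cong {p} {p′} {r} {r′} p≃p′ r≃r′ = mk≃ λ f → begin
    (p *ₚ r) ⊙ f     ≈⟨ *ₚ-⊙ p r f ⟩
    p ⊙ r ⊙ f        ≈⟨ ⊙-≐ p≃p′ (r ⊙ f) ⟩
    p′ ⊙ r ⊙ f       ≈⟨ ⊙-cong p′ (⊙-≐ r≃r′ f) ⟩
    p′ ⊙ r′ ⊙ f      ≈⟨ *ₚ-⊙ p′ r′ f ⟨
    (p′ *ₚ r′) ⊙ f   ∎
    where open 𝓕 using (begin_; _∎; step-≈-⟩; step-≈-⟨)

  *ₚ-assoc : ∀ p r s → (p *ₚ r) *ₚ s ≃ p *ₚ (r *ₚ s)
  *ₚ-assoc p r s = mk≃ λ f → 𝓕.trans (𝓕.trans (*ₚ-⊙ (p *ₚ r) s f) (*ₚ-⊙ p r (s ⊙ f)))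
    (𝓕.sym (𝓕.trans (*ₚ-⊙ p (r *ₚ s) f) (⊙-cong p (*ₚ-⊙ r s f))))

  *ₚ-comm : ∀ p r → p *ₚ r ≃ r *ₚ p
  *ₚ-comm p r = mk≃ λ f → 𝓕.trans (*ₚ-⊙ p r f) (𝓕.trans (⊙-comm p r f) (𝓕.sym (*ₚ-⊙ r p f)))

  *ₚ-identityˡ : ∀ p → (+ 1 ∷ []) *ₚ p ≃ p
  *ₚ-identityˡ p = mk≃ λ f → 𝓕.trans (*ₚ-⊙ (+ 1 ∷ []) p f) (1ₚ-⊙ (p ⊙ f))

  *ₚ-distribʳ : ∀ p r s → (r +ₚ s) *ₚ p ≃ r *ₚ p +ₚ s *ₚ p
  *ₚ-distribʳ p r s = mk≃ λ f → begin
    ((r +ₚ s) *ₚ p) ⊙ f                ≈⟨ 𝓕.trans (*ₚ-⊙ (r +ₚ s) p f) (+ₚ-⊙ r s (p ⊙ f)) ⟩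
    r ⊙ p ⊙ f ⊕ s ⊙ p ⊙ f              ≈⟨ 𝓕.+-cong (*ₚ-⊙ r p f) (*ₚ-⊙ s p f) ⟨
    (r *ₚ p) ⊙ f ⊕ (s *ₚ p) ⊙ f        ≈⟨ +ₚ-⊙ (r *ₚ p) (s *ₚ p) f ⟨
    (r *ₚ p +ₚ s *ₚ p) ⊙ f             ∎
    where open 𝓕 using (begin_; _∎; step-≈-⟩; step-≈-⟨)

  ≃-isCommutativeRing : IsCommutativeRing _≃_ _+ₚ_ _*ₚ_ negₚ [] (+ 1 ∷ [])
  ≃-isCommutativeRing = record
    { isRing = record
      { +-isAbelianGroup = record
        { isGroup = record
          { isMonoid = record
            { isSemigroup = record
              { isMagma = record { isEquivalence = ≃-isEquivalence ; ∙-cong = +ₚ-cong }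
              ; assoc = +ₚ-assoc }
            ; identity = (λ _ → IsEquivalence.refl ≃-isEquivalence) , +ₚ-identityʳ }
          ; inverse = negₚ-inverseˡ , negₚ-inverseʳ
          ; ⁻¹-cong = negₚ-cong }
        ; comm = +ₚ-comm }
      ; *-cong = *ₚ-cong
      ; *-assoc = *ₚ-assoc
      ; *-identity = comm∧idˡ⇒id *ₚ-comm *ₚ-identityˡ
      ; distrib = comm∧distrʳ⇒distr +ₚ-cong *ₚ-comm *ₚ-distribʳ }
    ; *-comm = *ₚ-comm }
    where open import Algebra.Consequences.Setoid ≃-setoid using (comm∧idˡ⇒id; comm∧distrʳ⇒distr)

  𝓞 : CommutativeRing 0ℓ (c ⊔ ℓ)
  𝓞 = record { isCommutativeRing = ≃-isCommutativeRing }

  module 𝓞 = CommutativeRing 𝓞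

  2x : Polyℤ
  2x = + 0 ∷ + 2 ∷ []

  2x-⊙ : ∀ f → 2x ⊙ f ≐ ιℤ (+ 2) · μ₁ f
  2x-⊙ f = 𝓕.trans (0∷-⊙ (+ 2 ∷ []) f) (𝓕.trans (μ₁-cong {g = ιℤ (+ 2) · f} (λ v → trans (+-congˡ (μ₁-0 v)) (+-identityʳ _))) (μ₁-· _ f))

  open Lucas 𝓞 2x public using (u; u₂≈x; _∈⟨_,_⟩; u-gcd∈⟨u,u⟩)

  0∷2p≃2x*p : ∀ p → (+ 0 ∷ scaleₚ (+ 2) p) ≃ 2x *ₚ p
  0∷2p≃2x*p p = mk≃ λ f → begin
    (+ 0 ∷ scaleₚ (+ 2) p) ⊙ f   ≈⟨ 𝓕.trans (0∷-⊙ (scaleₚ (+ 2) p) f) (μ₁-cong (scaleₚ-⊙ (+ 2) p f)) ⟩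
    μ₁ (ιℤ (+ 2) · p ⊙ f)        ≈⟨ μ₁-· _ (p ⊙ f) ⟩
    ιℤ (+ 2) · μ₁ (p ⊙ f)        ≈⟨ 𝓕.trans (*ₚ-⊙ 2x p f) (2x-⊙ (p ⊙ f)) ⟨
    (2x *ₚ p) ⊙ f                ∎
    where open 𝓕 using (begin_; _∎; step-≈-⟩; step-≈-⟨)

  U≃u : ∀ n → U n ≃ u (suc n)
  U≃u zero = 𝓞.refl
  U≃u (suc zero) = 𝓞.sym u₂≈x
  U≃u (suc (suc n)) = 𝓞.+-cong (𝓞.trans (0∷2p≃2x*p (U (suc n))) (𝓞.*-congˡ {2x} (U≃u (suc n)))) (𝓞.-‿cong (U≃u n))

  ≈ₚ⇒≃ : ∀ {p r} → p ≈ₚ r → p ≃ r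
  ≈ₚ⇒≃ {p} {r} p≈r = mk≃ (≈ₚ-⊙ p r p≈r)

  U∸1≃u : ∀ n → n ≢ 0 → U (n ∸ 1) ≃ u n
  U∸1≃u zero 0≢0 = contradiction ≡.refl 0≢0
  U∸1≃u (suc n) _ = U≃u n

  ∈⟨⟩-solution : ∀ {A B D G H} → D ∈⟨ A , B ⟩ → A ⊙ G ≐ B ⊙ H → Σ 𝓕 λ φ → (A ⊙ φ ≐ D ⊙ H) × (B ⊙ φ ≐ D ⊙ G)
  ∈⟨⟩-solution {A} {B} {D} {G} {H} (s , t , sA+tB≃D) AG≐BH = s ⊙ H ⊕ t ⊙ G , (begin
      A ⊙ (s ⊙ H ⊕ t ⊙ G)        ≈⟨ ⊙-+ A (s ⊙ H) (t ⊙ G) ⟩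
      A ⊙ s ⊙ H ⊕ A ⊙ t ⊙ G      ≈⟨ 𝓕.+-cong (⊙-comm A s H) (𝓕.trans (⊙-comm A t G) (⊙-cong t AG≐BH)) ⟩
      s ⊙ A ⊙ H ⊕ t ⊙ B ⊙ H      ≈⟨ combination-⊙ H ⟨
      (s *ₚ A +ₚ t *ₚ B) ⊙ H     ≈⟨ ⊙-≐ sA+tB≃D H ⟩
      D ⊙ H                      ∎) , (begin
      B ⊙ (s ⊙ H ⊕ t ⊙ G)        ≈⟨ ⊙-+ B (s ⊙ H) (t ⊙ G) ⟩
      B ⊙ s ⊙ H ⊕ B ⊙ t ⊙ G      ≈⟨ 𝓕.+-cong (𝓕.trans (⊙-comm B s H) (⊙-cong s (𝓕.sym AG≐BH))) (⊙-comm B t G) ⟩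
      s ⊙ A ⊙ G ⊕ t ⊙ B ⊙ G      ≈⟨ combination-⊙ G ⟨
      (s *ₚ A +ₚ t *ₚ B) ⊙ G     ≈⟨ ⊙-≐ sA+tB≃D G ⟩
      D ⊙ G                      ∎)
    where
    open 𝓕 using (begin_; _∎; step-≈-⟩; step-≈-⟨)
    combination-⊙ : ∀ f → (s *ₚ A +ₚ t *ₚ B) ⊙ f ≐ s ⊙ A ⊙ f ⊕ t ⊙ B ⊙ f
    combination-⊙ f = 𝓕.trans (+ₚ-⊙ (s *ₚ A) (t *ₚ B) f) (𝓕.+-cong (*ₚ-⊙ s A f) (*ₚ-⊙ t B f))

  -- Waves

  u-step-⊙ : ∀ n g → u (suc (suc n)) ⊙ g ≐ 2x ⊙ u (suc n) ⊙ g ⊖ u n ⊙ g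
  u-step-⊙ n g = 𝓕.trans (+ₚ-⊙ (2x *ₚ u (suc n)) (negₚ (u n)) g) (𝓕.+-cong (*ₚ-⊙ 2x (u (suc n)) g) (negₚ-⊙ (u n) g))

  Recurrent : (ℕ → 𝓕) → Set ℓ
  Recurrent s = ∀ n → s (suc (suc n)) ⊕ s n ≐ 2x ⊙ s (suc n)

  closed-form : ∀ s → Recurrent s → ∀ n → s (suc n) ⊕ u n ⊙ s 0 ≐ u (suc n) ⊙ s 1
  closed-form s rec zero = 𝓕.trans (𝓕.+-identityʳ (s 1)) (𝓕.sym (1ₚ-⊙ (s 1)))
  closed-form s rec (suc zero) = 𝓕.trans (𝓕.+-congˡ (1ₚ-⊙ (s 0))) (𝓕.trans (rec 0) (⊙-≐ (𝓞.sym u₂≈x) (s 1)))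
  closed-form s rec (suc (suc n)) = begin
    s (3 ℕ.+ n) ⊕ u (2 ℕ.+ n) ⊙ s 0
      ≈⟨ 𝓕.+-congˡ (u-step-⊙ n (s 0)) ⟩
    s (3 ℕ.+ n) ⊕ (2x ⊙ u (suc n) ⊙ s 0 ⊖ u n ⊙ s 0)
      ≈⟨ (λ v → solve 4 (λ S₃ S₁ Y Z → S₃ :+ (Y :- Z) := (S₃ :+ S₁) :+ Y :- (S₁ :+ Z)) refl
                 (s (3 ℕ.+ n) v) (s (suc n) v) ((2x ⊙ u (suc n) ⊙ s 0) v) ((u n ⊙ s 0) v)) ⟩
    (s (3 ℕ.+ n) ⊕ s (suc n)) ⊕ 2x ⊙ u (suc n) ⊙ s 0 ⊖ (s (suc n) ⊕ u n ⊙ s 0)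
      ≈⟨ 𝓕.+-cong (𝓕.+-congʳ (rec (suc n))) (𝓕.-‿cong (closed-form s rec n)) ⟩
    2x ⊙ s (2 ℕ.+ n) ⊕ 2x ⊙ u (suc n) ⊙ s 0 ⊖ u (suc n) ⊙ s 1
      ≈⟨ 𝓕.+-congʳ (⊙-+ 2x (s (2 ℕ.+ n)) (u (suc n) ⊙ s 0)) ⟨
    2x ⊙ (s (2 ℕ.+ n) ⊕ u (suc n) ⊙ s 0) ⊖ u (suc n) ⊙ s 1
      ≈⟨ 𝓕.+-congʳ (⊙-cong 2x (closed-form s rec (suc n))) ⟩
    2x ⊙ u (2 ℕ.+ n) ⊙ s 1 ⊖ u (suc n) ⊙ s 1
      ≈⟨ u-step-⊙ (suc n) (s 1) ⟨
    u (3 ℕ.+ n) ⊙ s 1 ∎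
    where open 𝓕 using (begin_; _∎; step-≈-⟩; step-≈-⟨)

  recurrent-value⇔ : ∀ s → Recurrent s → ∀ n x → s (2 ℕ.+ n) ≐ x ⇔ U (suc n) ⊙ s 1 ≐ x ⊕ U n ⊙ s 0
  recurrent-value⇔ s rec n x = mk⇔ (λ s≐x → 𝓕.trans (𝓕.sym closed) (𝓕.+-congʳ s≐x))
                         (λ U⊙s≐ → 𝓕.+-cancelʳ (U n ⊙ s 0) _ _ (𝓕.trans closed U⊙s≐))
    where
    closed : s (2 ℕ.+ n) ⊕ U n ⊙ s 0 ≐ U (suc n) ⊙ s 1
    closed = 𝓕.trans (𝓕.+-congˡ (⊙-≐ (U≃u n) (s 0)))
      (𝓕.trans (closed-form s rec (suc n)) (⊙-≐ (𝓞.sym (U≃u (suc n))) (s 1)))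

  wave-step⇔ : ∀ g h → μ₁ g ≐ half · h ⇔ h ≐ 2x ⊙ g
  wave-step⇔ g h = mk⇔
    (λ μ₁g≐ v → begin
      h v                        ≈⟨ *-identityˡ _ ⟨
      1# * h v                   ≈⟨ *-congʳ two-half ⟨
      ιℕ 2 * half * h v          ≈⟨ *-assoc _ _ _ ⟩
      ιℕ 2 * (half * h v)        ≈⟨ *-congˡ (μ₁g≐ v) ⟨
      ιℕ 2 * μ₁ g v              ≈⟨ 2x-⊙ g v ⟨
      (2x ⊙ g) v                 ∎)
    (λ h≐ v → begin
      μ₁ g v                     ≈⟨ *-identityˡ _ ⟨
      1# * μ₁ g v                ≈⟨ *-congʳ (trans (*-comm _ _) two-half) ⟨
      half * ιℕ 2 * μ₁ g v       ≈⟨ *-assoc _ _ _ ⟩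
      half * (ιℕ 2 * μ₁ g v)     ≈⟨ *-congˡ (trans (h≐ v) (2x-⊙ g v)) ⟨
      half * h v                 ∎)
    where
    open Reasoning setoid
    two-half : ιℕ 2 * half ≈ 1#
    two-half = proj₂ (inverse (ιℕ 2) (char0 1))

  wave-recurrent : ∀ F → IsWave F → Recurrent (F ∘ +_)
  wave-recurrent F F-wave n = Equivalence.to (wave-step⇔ _ _) (F-wave′ n)
    where
    F-wave′ : ∀ n → μ₁ (F (+ suc n)) ≐ half · (F (+ suc (suc n)) ⊕ F (+ n))
    F-wave′ n with F-wave (+ suc n)
    ... | w rewrite ℕ.+-comm n 1 = w

  orbit : 𝓕 → 𝓕 → ℕ → 𝓕
  orbit f g zero = f
  orbit f g (suc zero) = g
  orbit f g (suc (suc n)) = 2x ⊙ orbit f g (suc n) ⊖ orbit f g n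

  orbit-recurrent : ∀ f g → Recurrent (orbit f g)
  orbit-recurrent f g n v = solve 2 (λ A B → A :- B :+ B := A) refl _ _

  wave : 𝓕 → 𝓕 → ℤ → 𝓕
  wave f g (+ n) = orbit f g n
  wave f g -[1+ n ] = orbit f (2x ⊙ f ⊖ g) (suc n)

  wave-isWave : ∀ f g → IsWave (wave f g)
  wave-isWave f g j = Equivalence.from (wave-step⇔ _ _) (neighbours j)
    where
    g₋₁ : 𝓕
    g₋₁ = 2x ⊙ f ⊖ g
    neighbours : ∀ j → wave f g (j ℤ.+ + 1) ⊕ wave f g (j ℤ.- + 1) ≐ 2x ⊙ wave f g j
    neighbours (+ zero) v = solve 2 (λ G Y → G :+ (Y :- G) := Y) refl _ _
    neighbours (+ suc n) rewrite ℕ.+-comm n 1 = orbit-recurrent f g n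
    neighbours -[1+ zero ] = 𝓕.trans (𝓕.+-comm _ _) (orbit-recurrent f g₋₁ 0)
    neighbours -[1+ suc n ] rewrite ℕ.+-identityʳ n = 𝓕.trans (𝓕.+-comm _ _) (orbit-recurrent f g₋₁ (suc n))

  module _ (f : 𝓕) where
    wave⇒U-solution : ∀ F → IsWave F → F (+ 0) ≐ f → ∀ n {x} → F (+ (2 ℕ.+ n)) ≐ x → U (suc n) ⊙ F (+ 1) ≐ x ⊕ U n ⊙ f
    wave⇒U-solution F F-wave F₀≐f n Fn≐x =
      𝓕.trans (Equivalence.to (recurrent-value⇔ (F ∘ +_) (wave-recurrent F F-wave) n _) Fn≐x) (𝓕.+-congˡ (⊙-cong (U n) F₀≐f))

    U-solution⇒wave : ∀ φ n {x} → U (suc n) ⊙ φ ≐ x ⊕ U n ⊙ f → wave f φ (+ (2 ℕ.+ n)) ≐ x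
    U-solution⇒wave φ n = Equivalence.from (recurrent-value⇔ (orbit f φ) (orbit-recurrent f φ) n _)

  wave-through⇔ : ∀ k l f g h →
    Σ (ℤ → 𝓕) (λ F → IsWave F × (F (+ 0) ≐ f) × (F (+ (2 ℕ.+ l)) ≐ g) × (F (+ (2 ℕ.+ k)) ≐ h))
    ⇔ Σ 𝓕 (λ φ → (U (suc l) ⊙ φ ≐ g ⊕ U l ⊙ f) × (U (suc k) ⊙ φ ≐ h ⊕ U k ⊙ f))
  wave-through⇔ k l f g h = mk⇔
    (λ (F , F-wave , F₀≐f , Fl≐g , Fk≐h) →
      F (+ 1) , wave⇒U-solution f F F-wave F₀≐f l Fl≐g , wave⇒U-solution f F F-wave F₀≐f k Fk≐h)
    (λ (φ , Ulφ≐ , Ukφ≐) →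
      wave f φ , wave-isWave f φ , 𝓕.refl , U-solution⇒wave f φ l Ulφ≐ , U-solution⇒wave f φ k Ukφ≐)

  -- Surjectivity of polynomials in μ₁

  -- cs and α stand for cs ++ [ α ] ∈ K[x], constant term first; keeping the leading coefficient α
  -- apart lets α ≉ 0 pass unchanged to the quotient by x - r.
  polyᴷ[μ₁] : List Carrier → Carrier → 𝓕 → 𝓕
  polyᴷ[μ₁] [] α f = α · f
  polyᴷ[μ₁] (a ∷ cs) α f = a · f ⊕ μ₁ (polyᴷ[μ₁] cs α f)

  evalᴷ : List Carrier → Carrier → Carrier → Carrier
  evalᴷ [] α x = α
  evalᴷ (a ∷ cs) α x = a + x * evalᴷ cs α x

  quotientᴷ : Carrier → List Carrier → Carrier → List Carrier
  quotientᴷ r [] α = []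
  quotientᴷ r (b ∷ cs) α = evalᴷ (b ∷ cs) α r ∷ quotientᴷ r cs α

  length-quotientᴷ : ∀ r cs α → length (quotientᴷ r cs α) ≡ length cs
  length-quotientᴷ r [] α = ≡.refl
  length-quotientᴷ r (b ∷ cs) α = ≡.cong suc (length-quotientᴷ r cs α)

  -- p(x) + r q(x) = x q(x) + p(r), i.e. p(x) - p(r) = (x - r) q(x) without subtraction.
  synthetic-division : ∀ r a cs α f → let Q = polyᴷ[μ₁] (quotientᴷ r cs α) α f in
    polyᴷ[μ₁] (a ∷ cs) α f ⊕ r · Q ≐ μ₁ Q ⊕ evalᴷ (a ∷ cs) α r · f
  synthetic-division r a [] α f v =
    solve 5 (λ A F M R U → A :* F :+ M :+ R :* (U :* F) := M :+ (A :+ R :* U) :* F) refl a (f v) (μ₁ (α · f) v) r α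
  synthetic-division r a (b ∷ cs) α f v = begin
    a * f v + μ₁ P v + r * (e * f v + μ₁ Q′ v)
      ≈⟨ solve 6 (λ A F MP R E MQ → A :* F :+ MP :+ R :* (E :* F :+ MQ) := (MP :+ R :* MQ) :+ (A :+ R :* E) :* F)
           refl a (f v) (μ₁ P v) r e (μ₁ Q′ v) ⟩
    (μ₁ P v + r * μ₁ Q′ v) + (a + r * e) * f v
      ≈⟨ +-congʳ (sym (μ₁-+· P r Q′ v)) ⟩
    μ₁ (P ⊕ r · Q′) v + (a + r * e) * f v
      ≈⟨ +-congʳ (μ₁-cong (synthetic-division r b cs α f) v) ⟩
    μ₁ (μ₁ Q′ ⊕ e · f) v + (a + r * e) * f v
      ≈⟨ +-congʳ (μ₁-cong {g = e · f ⊕ μ₁ Q′} (λ _ → +-comm _ _) v) ⟩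
    μ₁ (e · f ⊕ μ₁ Q′) v + (a + r * e) * f v ∎
    where
    open Reasoning setoid
    P Q′ : 𝓕
    P = polyᴷ[μ₁] (b ∷ cs) α f
    Q′ = polyᴷ[μ₁] (quotientᴷ r cs α) α f
    e : Carrier
    e = evalᴷ (b ∷ cs) α r

  -- algClosed provides roots of monic polynomials, here of α⁻¹ times the polynomial (a ∷ cs , α).
  evalK-monic : ∀ {α⁻¹ α} → α⁻¹ * α ≈ 1# → ∀ cs x → evalK (map (α⁻¹ *_) cs ++ [ 1# ]) x ≈ α⁻¹ * evalᴷ cs α x
  evalK-monic α⁻¹α≈1 [] x = trans (+-congˡ (zeroʳ x)) (trans (+-identityʳ 1#) (sym α⁻¹α≈1))
  evalK-monic {α⁻¹} α⁻¹α≈1 (a ∷ cs) x = trans (+-congˡ (*-congˡ (evalK-monic α⁻¹α≈1 cs x)))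
    (solve 4 (λ W A X E → W :* A :+ X :* (W :* E) := W :* (A :+ X :* E)) refl α⁻¹ a x _)

  root : ∀ a cs α → ¬ α ≈ 0# → Σ Carrier λ r → evalᴷ (a ∷ cs) α r ≈ 0#
  root a cs α α≉0 with inverse α α≉0
  ... | α⁻¹ , αα⁻¹≈1 with algClosed (α⁻¹ * a) (map (α⁻¹ *_) cs)
  ... | x , x-root = x , (begin
    evalᴷ (a ∷ cs) α x                           ≈⟨ *-identityˡ _ ⟨
    1# * evalᴷ (a ∷ cs) α x                      ≈⟨ *-congʳ αα⁻¹≈1 ⟨
    α * α⁻¹ * evalᴷ (a ∷ cs) α x                 ≈⟨ *-assoc _ _ _ ⟩
    α * (α⁻¹ * evalᴷ (a ∷ cs) α x)               ≈⟨ *-congˡ (evalK-monic (trans (*-comm α⁻¹ α) αα⁻¹≈1) (a ∷ cs) x) ⟨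
    α * evalK (map (α⁻¹ *_) (a ∷ cs) ++ [ 1# ]) x ≈⟨ *-congˡ x-root ⟩
    α * 0#                                       ≈⟨ zeroʳ α ⟩
    0#                                           ∎)
    where open Reasoning setoid

  ιℕ≉0 : ∀ {m} → 1 ℕ.≤ m → ¬ ιℕ m ≈ 0#
  ιℕ≉0 {suc m} _ = char0 m

  ++-⊙ : ∀ cs x f → (cs ++ [ x ]) ⊙ f ≐ polyᴷ[μ₁] (map ιℤ cs) (ιℤ x) f
  ++-⊙ [] x f v = trans (+-congˡ (μ₁-0 v)) (+-identityʳ _)
  ++-⊙ (a ∷ cs) x f v = +-congˡ (μ₁-cong (++-⊙ cs x f) v)

  module _ (1≤q : 1 ℕ.≤ q) where
    open import Data.Fin using (fromℕ<; punchIn)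
    open import Data.Fin.Properties using (_≟_; punchInᵢ≢i; punchIn-injective)
    open import Data.Unit using (tt)
    open import Relation.Nullary using (yes; no)

    -- The designated child of a vertex; it differs from the parent direction, which needs q ≥ 1.
    next : List (Fin (suc q)) → Fin (suc q)
    next [] = zero
    next (b ∷ _) = punchIn b (fromℕ< 1≤q)

    -- μ₁ φ = χ + ρ φ is solved outward from the root: all children of w except the designated one
    -- get the value 0, and the value at the designated child is forced by the equation at w.
    module TreeSolution (ρ : Carrier) (χ : 𝓕) where
      mutual
        ψ : (w : List (Fin (suc q))) → Reduced w → Carrier
        ψ [] _ = 0#
        ψ (a ∷ w) r with a ≟ next w
        ... | yes _ = child w (Reduced-tail r)
        ... | no _ = 0#

        child : (w : List (Fin (suc q))) → Reduced w → Carrier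
        child w r = ιℕ (suc q) * (χ (w , r) + ρ * ψ w r) - parent w r

        parent : (w : List (Fin (suc q))) → Reduced w → Carrier
        parent [] _ = 0#
        parent (b ∷ w) r = ψ w (Reduced-tail r)

      φ : 𝓕
      φ (w , r) = ψ w r

      φ-word : ∀ (v : 𝔛) {w} (r : Reduced w) → proj₁ v ≡ w → φ v ≡ ψ w r
      φ-word (w , r′) r ≡.refl = ≡.cong (ψ w) (Reduced-irrelevant w r′ r)

      ψ-next : ∀ w (r : Reduced (next w ∷ w)) → ψ (next w ∷ w) r ≡ child w (Reduced-tail r)
      ψ-next w r with next w ≟ next w
      ... | yes _ = ≡.refl
      ... | no n≢n = contradiction ≡.refl n≢n

      ψ-other : ∀ a w (r : Reduced (a ∷ w)) → a ≢ next w → ψ (a ∷ w) r ≡ 0#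
      ψ-other a w r a≢n with a ≟ next w
      ... | yes a≡n = contradiction a≡n a≢n
      ... | no _ = ≡.refl

      neighbour-sum : ∀ w r → sum (λ a → φ (step a (w , r))) ≈ parent w r + child w r
      neighbour-sum [] r = begin
        sum (λ a → ψ (a ∷ []) tt)   ≈⟨ sum-pick +-commutativeMonoid _ zero (λ a a≢0 → reflexive (ψ-other a [] tt a≢0)) ⟩
        ψ (zero ∷ []) tt           ≡⟨ ψ-next [] tt ⟩
        child [] tt                ≈⟨ +-identityˡ _ ⟨
        0# + child [] tt           ∎
        where open Reasoning setoid
      neighbour-sum (b ∷ w) r = begin
        sum t                                   ≈⟨ sum-remove {i = b} t ⟩
        t b + sum (t ∘ punchIn b)               ≈⟨ +-cong (reflexive (φ-word _ (Reduced-tail r) (step-back b w r)))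
                                                          (sum-pick +-commutativeMonoid _ i₀ others) ⟩
        parent (b ∷ w) r + t (punchIn b i₀)     ≡⟨ ≡.cong (_+_ (parent (b ∷ w) r)) (≡.trans (φ-word _ r′ (step-forward w r b′≢b)) (ψ-next (b ∷ w) r′)) ⟩
        parent (b ∷ w) r + child (b ∷ w) r      ∎
        where
        open Reasoning setoid
        open import Algebra.Properties.CommutativeMonoid.Sum +-commutativeMonoid using (sum-remove)
        i₀ : Fin q
        i₀ = fromℕ< 1≤q
        t : Fin (suc q) → Carrier
        t a = φ (step a (b ∷ w , r))
        b′≢b : punchIn b i₀ ≢ b
        b′≢b = punchInᵢ≢i b i₀
        r′ : Reduced (punchIn b i₀ ∷ b ∷ w)
        r′ = Reduced-∷ b′≢b r
        others : ∀ i → i ≢ i₀ → t (punchIn b i) ≈ 0#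
        others i i≢i₀ = reflexive (≡.trans (φ-word _ (Reduced-∷ (punchInᵢ≢i b i) r) (step-forward w r (punchInᵢ≢i b i)))
          (ψ-other _ (b ∷ w) _ (i≢i₀ ∘ punchIn-injective b i i₀)))

      solution : μ₁ φ ≐ χ ⊕ ρ · φ
      solution (w , r) = begin
        μ₁ φ (w , r)                                           ≡⟨ μ₁≡sum φ (w , r) ⟩
        1/[1+q] * sum (λ a → φ (step a (w , r)))               ≈⟨ *-congˡ (neighbour-sum w r) ⟩
        1/[1+q] * (parent w r + child w r)                     ≈⟨ *-congˡ (solve 3 (λ P N Y → P :+ (N :* Y :- P) := N :* Y) refl _ _ _) ⟩
        1/[1+q] * (ιℕ (suc q) * (χ (w , r) + ρ * ψ w r))       ≈⟨ *-assoc _ _ _ ⟨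
        1/[1+q] * ιℕ (suc q) * (χ (w , r) + ρ * ψ w r)         ≈⟨ *-congʳ (trans (*-comm _ _) (proj₂ (inverse (ιℕ (suc q)) (char0 q)))) ⟩
        1# * (χ (w , r) + ρ * ψ w r)                           ≈⟨ *-identityˡ _ ⟩
        χ (w , r) + ρ * ψ w r                                  ∎
        where open Reasoning setoid

    μ₁-shift-surjective : ∀ ρ χ → Σ 𝓕 λ φ → μ₁ φ ≐ χ ⊕ ρ · φ
    μ₁-shift-surjective ρ χ = φ , solution
      where open TreeSolution ρ χ

    polyᴷ[μ₁]-surjective : ∀ n cs α → length cs ≡ n → ¬ α ≈ 0# → ∀ χ → Σ 𝓕 λ φ → polyᴷ[μ₁] cs α φ ≐ χ
    polyᴷ[μ₁]-surjective zero [] α _ α≉0 χ = inv α α≉0 · χ , λ v →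
      trans (sym (*-assoc _ _ _)) (trans (*-congʳ (proj₂ (inverse α α≉0))) (*-identityˡ _))
    polyᴷ[μ₁]-surjective (suc n) (a ∷ cs) α len α≉0 χ with root a cs α α≉0
    ... | r , r-root with μ₁-shift-surjective r χ
    ... | ψ , μ₁ψ≐ with polyᴷ[μ₁]-surjective n (quotientᴷ r cs α) α (≡.trans (length-quotientᴷ r cs α) (ℕ.suc-injective len)) α≉0 ψ
    ... | φ , Q≐ψ = φ , 𝓕.+-cancelʳ (r · Q) _ _ (begin
      polyᴷ[μ₁] (a ∷ cs) α φ ⊕ r · Q   ≈⟨ synthetic-division r a cs α φ ⟩
      μ₁ Q ⊕ evalᴷ (a ∷ cs) α r · φ   ≈⟨ 𝓕.+-cong (μ₁-cong Q≐ψ) (λ v → trans (*-congʳ r-root) (zeroˡ _)) ⟩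
      μ₁ ψ ⊕ 𝓕.0#                     ≈⟨ 𝓕.+-identityʳ _ ⟩
      μ₁ ψ                            ≈⟨ μ₁ψ≐ ⟩
      χ ⊕ r · ψ                       ≈⟨ 𝓕.+-congˡ (λ v → *-congˡ (sym (Q≐ψ v))) ⟩
      χ ⊕ r · Q                       ∎)
      where
      open 𝓕 using (begin_; _∎; step-≈-⟩; step-≈-⟨)
      Q : 𝓕
      Q = polyᴷ[μ₁] (quotientᴷ r cs α) α φ

    U-surjective : ∀ n χ → Σ 𝓕 λ φ → U n ⊙ φ ≐ χ
    U-surjective n χ with U-leading n
    ... | cs , len , U≡ rewrite U≡
        with polyᴷ[μ₁]-surjective n (map ιℤ cs) (ιℤ (+ (2 ℕ.^ n))) (≡.trans (length-map ιℤ cs) len) (ιℕ≉0 (ℕ.m^n>0 2 n)) χ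
    ... | φ , φ-solves = φ , 𝓕.trans (++-⊙ cs _ φ) φ-solves

  module Solvability {k l d : ℕ} {W V : Polyℤ} (d≢0 : d ≢ 0)
                     (WUd≈Uk : W *ₚ U (d ∸ 1) ≈ₚ U k) (VUd≈Ul : V *ₚ U (d ∸ 1) ≈ₚ U l) where
    open 𝓕 using (begin_; _∎; step-≈-⟩; step-≈-⟨)

    Ud : Polyℤ
    Ud = U (d ∸ 1)

    Ud≃ud : Ud ≃ u d
    Ud≃ud = U∸1≃u d d≢0

    WUd≃uₖ : W *ₚ Ud ≃ u (suc k)
    WUd≃uₖ = 𝓞.trans (≈ₚ⇒≃ WUd≈Uk) (U≃u k)

    VUd≃uₗ : V *ₚ Ud ≃ u (suc l)
    VUd≃uₗ = 𝓞.trans (≈ₚ⇒≃ VUd≈Ul) (U≃u l)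

    solution⇒condition : ∀ {G H} → Σ 𝓕 (λ φ → (U l ⊙ φ ≐ G) × (U k ⊙ φ ≐ H)) → W ⊙ G ≐ V ⊙ H
    solution⇒condition {G} {H} (φ , Ulφ≐G , Ukφ≐H) = begin
      W ⊙ G            ≈⟨ 𝓕.trans (*ₚ-⊙ W (U l) φ) (⊙-cong W Ulφ≐G) ⟨
      (W *ₚ U l) ⊙ φ   ≈⟨ ⊙-≐ WUl≃VUk φ ⟩
      (V *ₚ U k) ⊙ φ   ≈⟨ 𝓕.trans (*ₚ-⊙ V (U k) φ) (⊙-cong V Ukφ≐H) ⟩
      V ⊙ H            ∎
      where
      open import Algebra.Properties.CommutativeSemigroup 𝓞.*-commutativeSemigroup using () renaming (x∙yz≈y∙xz to x*yz≈y*xz)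
      WUl≃VUk : W *ₚ U l ≃ V *ₚ U k
      WUl≃VUk = 𝓞.trans (𝓞.*-congˡ {W} (𝓞.sym (≈ₚ⇒≃ VUd≈Ul)))
        (𝓞.trans (x*yz≈y*xz W V Ud) (𝓞.*-congˡ {V} (≈ₚ⇒≃ WUd≈Uk)))

    lifted-condition : ∀ {G H G₁ H₁} → W ⊙ G ≐ V ⊙ H → Ud ⊙ G₁ ≐ G → Ud ⊙ H₁ ≐ H → u (suc k) ⊙ G₁ ≐ u (suc l) ⊙ H₁
    lifted-condition {G} {H} {G₁} {H₁} WG≐VH UdG₁≐G UdH₁≐H = begin
      u (suc k) ⊙ G₁   ≈⟨ 𝓕.trans (⊙-≐ (𝓞.sym WUd≃uₖ) G₁) (*ₚ-⊙ W Ud G₁) ⟩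
      W ⊙ Ud ⊙ G₁      ≈⟨ ⊙-cong W UdG₁≐G ⟩
      W ⊙ G            ≈⟨ WG≐VH ⟩
      V ⊙ H            ≈⟨ ⊙-cong V UdH₁≐H ⟨
      V ⊙ Ud ⊙ H₁      ≈⟨ 𝓕.trans (𝓕.sym (*ₚ-⊙ V Ud H₁)) (⊙-≐ VUd≃uₗ H₁) ⟩
      u (suc l) ⊙ H₁   ∎

    through-Ud : ∀ {P′ P φ X Y} → P′ ≃ P → P ⊙ φ ≐ u d ⊙ X → Ud ⊙ X ≐ Y → P′ ⊙ φ ≐ Y
    through-Ud {φ = φ} P′≃P Pφ≐ UdX≐Y = 𝓕.trans (⊙-≐ P′≃P φ) (𝓕.trans Pφ≐ (𝓕.trans (⊙-≐ (𝓞.sym Ud≃ud) _) UdX≐Y))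

    condition⇒solution : 1 ℕ.≤ q → u d ∈⟨ u (suc k) , u (suc l) ⟩ →
                         ∀ {G H} → W ⊙ G ≐ V ⊙ H → Σ 𝓕 (λ φ → (U l ⊙ φ ≐ G) × (U k ⊙ φ ≐ H))
    condition⇒solution 1≤q d∈⟨uₖ,uₗ⟩ {G} {H} WG≐VH with U-surjective 1≤q (d ∸ 1) G | U-surjective 1≤q (d ∸ 1) H
    ... | G₁ , UdG₁≐G | H₁ , UdH₁≐H with ∈⟨⟩-solution d∈⟨uₖ,uₗ⟩ (lifted-condition WG≐VH UdG₁≐G UdH₁≐H)
    ... | φ , uₖφ≐ , uₗφ≐ = φ , through-Ud (U≃u l) uₗφ≐ UdG₁≐G , through-Ud (U≃u k) uₖφ≐ UdH₁≐H

  solvable⇔ : 1 ℕ.≤ q → ∀ k l (W V : Polyℤ) →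
    W *ₚ U (gcd (suc k) (suc l) ∸ 1) ≈ₚ U k → V *ₚ U (gcd (suc k) (suc l) ∸ 1) ≈ₚ U l →
    ∀ G H → W ⊙ G ≐ V ⊙ H ⇔ Σ 𝓕 (λ φ → (U l ⊙ φ ≐ G) × (U k ⊙ φ ≐ H))
  solvable⇔ 1≤q k l W V WUd≈Uk VUd≈Ul G H =
    mk⇔ (condition⇒solution 1≤q (u-gcd∈⟨u,u⟩ (suc k) (suc l))) solution⇒condition
    where open Solvability {k} {l} {gcd (suc k) (suc l)} {W} {V} (gcd[m,n]≢0 (suc k) (suc l) (inj₁ λ ())) WUd≈Uk VUd≈Ul

-- k < l is only used to get l ≥ 2.
theorem5p6 : ∀ {c ℓ} (K : ACField0 c ℓ) (q : ℕ) → 1 ≤ q →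
    let open TreeAnalysis K q in
    ∀ (k l : ℕ) → 2 ≤ k → k < l →
    ∀ (W V : Polyℤ) →
    W *ₚ U (gcd k l ∸ 1) ≈ₚ U (k ∸ 1) →
    V *ₚ U (gcd k l ∸ 1) ≈ₚ U (l ∸ 1) →
    ∀ (f g h : 𝓕) →
    (poly[μ₁] W (g ⊕ poly[μ₁] (U (l ∸ 2)) f) ≐ poly[μ₁] V (h ⊕ poly[μ₁] (U (k ∸ 2)) f))
      ⇔ Σ (ℤ → 𝓕) (λ F → IsWave F × (F (+ 0) ≐ f) × (F (+ l) ≐ g) × (F (+ k) ≐ h))
theorem5p6 K q 1≤q (suc (suc k)) (suc (suc l)) (s≤s (s≤s _)) (s≤s (s≤s _)) W V WUd≈Uk VUd≈Ul f g h =
  ⇔-sym (wave-through⇔ k l f g h) ⇔-∘ solvable⇔ 1≤q (suc k) (suc l) W V WUd≈Uk VUd≈Ul _ _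
  where
  open OnTree K q
  open import Function.Construct.Composition using (_⇔-∘_)
  open import Function.Construct.Symmetry using (⇔-sym)
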